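{- Let $P=(X,\prec)$ be a finite poset with $|X|=n$ elements, and let $r$ be the number of maximal elements of $P$. Then for every $t\in\mathbb N$, $$\Omega(P,t)\ \geq\ t^r\,(t+1)^{n-r}\prod_{x\in X}\frac{1}{b(x)}.$$
   Context: For $x\in X$, $b(x):=|\{y\in X: y\succcurlyeq x\}|$ is the size of the upper order ideal generated by $x$. For an integer $t\ge 1$, $\Omega(P,t)$ (the order polynomial) is the number of maps $g:X\to[t]=\{1,\dots,t\}$ such that $g(x)\le g(y)$ whenever $x\prec y$. $\mathbb N=\{0,1,2,\dots\}$. -}

module Defs where

open import Level using (0ℓ)
open import Data.Nat using (ℕ; zero; suc; _≤_; _*_; _^_; _∸_)
open import Data.Fin as Fin using (Fin)
open import Data.Fin.Properties using (all?; _≟_)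
open import Data.List using (List; []; _∷_; [_]; map; concatMap; filter; length; allFin)
open import Data.Nat.ListAction using (product)
open import Data.Vec using (Vec; []; _∷_; lookup)
open import Data.Product using (_×_)
open import Relation.Nullary using (¬_; Dec; yes; no)
open import Relation.Nullary.Decidable using (_×-dec_; ¬?; _→-dec_)
open import Relation.Binary using (Rel; Decidable)
open import Relation.Binary.PropositionalEquality using (_≡_)

record FinPoset (n : ℕ) : Set₁ where
  field
    _≼_  : Rel (Fin n) 0ℓ
    _≼?_ : Decidable _≼_
    isPartialOrder : Relation.Binary.IsPartialOrder _≡_ _≼_

  _≺_ : Rel (Fin n) 0ℓ
  x ≺ y = (x ≼ y) × ¬ (x ≡ y)

  _≺?_ : Decidable _≺_
  x ≺? y = (x ≼? y) ×-dec ¬? (x ≟ y)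

open FinPoset public

allVecs : (n t : ℕ) → List (Vec (Fin t) n)
allVecs zero    t = [ [] ]
allVecs (suc n) t = concatMap (λ i → map (i ∷_) (allVecs n t)) (allFin t)

-- g : X → [t] (with [t] represented by Fin t, a shift preserving order)
-- is order preserving: g x ≤ g y whenever x ≺ y
OrderPreserving : ∀ {n t} → FinPoset n → (Fin n → Fin t) → Set
OrderPreserving P g = ∀ x y → _≺_ P x y → g x Fin.≤ g y

orderPreserving? : ∀ {n t} (P : FinPoset n) (g : Fin n → Fin t) → Dec (OrderPreserving P g)
orderPreserving? P g =
  all? (λ x → all? (λ y → _≺?_ P x y →-dec (g x Fin.≤? g y)))

Ω : ∀ {n} → FinPoset n → ℕ → ℕ
Ω {n} P t = length (filter (λ v → orderPreserving? P (lookup v)) (allVecs n t))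

b : ∀ {n} → FinPoset n → Fin n → ℕ
b {n} P x = length (filter (λ y → _≼?_ P x y) (allFin n))

IsMaximal : ∀ {n} → FinPoset n → Fin n → Set
IsMaximal {n} P x = ∀ y → ¬ (_≺_ P x y)

isMaximal? : ∀ {n} (P : FinPoset n) (x : Fin n) → Dec (IsMaximal P x)
isMaximal? P x = all? (λ y → ¬? (_≺?_ P x y))

numMax : ∀ {n} → FinPoset n → ℕ
numMax {n} P = length (filter (isMaximal? P) (allFin n))

prodB : ∀ {n} → FinPoset n → ℕ
prodB {n} P = product (map (b P) (allFin n))

-- Generalise Ω(P,t) to the number of order-preserving maps g : X → {0,…,t−1} with g ≥ ℓ, for a
-- monotone bound ℓ < t, and prove  ∏ₓ (t − ℓ x + [x not maximal]) ≤ #{such g} · ∏ₓ b(x);  for ℓ = 0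
-- this is the theorem.  Induct on |X| by deleting a minimal element m: sorting the maps by i = g(m)
-- leaves maps on X ∖ {m} whose bound is raised to i above m.  With L = t − ℓ(m), J = b(m) − 1 the
-- number of elements above m, a_y = t − ℓ(y), e_y = [y not maximal] and w = t − i, the step becomes
--   (L + [J > 0]) ∏_y (a_y + e_y) ≤ (J + 1) Σ_{w=1}^{L} ∏_y ((a_y ⊓ w if m ≺ y else a_y) + e_y).
-- Weighting the factorwise bound w (a + e) ≤ L (a ⊓ w + e) (for a, w ≤ L) by w^J reduces this to the
-- power-sum bound (L + 1) L^J ≤ (J + 1) Σ_{w=1}^{L} w^J, valid for J ≥ 1.

module Submission where

open import Defs
open import Data.Nat using (ℕ; _≤_; _*_; _^_; _∸_; suc)

open import Data.Bool using (true; false; if_then_else_)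
open import Data.Empty using (⊥-elim)
open import Data.Fin as Fin using (Fin; zero; suc; toℕ; punchIn; punchOut)
open import Data.Fin.Properties
  using (any?; all?; toℕ<n; punchIn-injective; punchInᵢ≢i; punchIn-punchOut) renaming (_≟_ to _≟ᶠ_)
open import Data.List as List using (List; []; _∷_; map; filter; length; allFin; concatMap; tabulate)
open import Data.List.Properties using (map-++; map-∘; map-tabulate)
open import Data.Nat using (zero; _+_; _<_; _⊓_; _⊔_; _≤?_; z≤n; s≤s; s≤s⁻¹; NonZero; >-nonZero)
open import Data.Nat.ListAction using (sum)
open import Data.Nat.ListAction.Properties using (sum-++)
open import Data.Nat.Properties
open import Algebra.Properties.CommutativeSemigroup *-commutativeSemigroup using (interchange; x∙yz≈y∙xz)
open import Data.Nat.Tactic.RingSolver using (solve-∀)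
open import Data.Product using (_×_; _,_; proj₁; proj₂; ∃)
open import Data.Sum using (_⊎_; inj₁; inj₂)
open import Data.Vec using (Vec; []; _∷_; lookup; insertAt)
open import Data.Vec.Functional as Vector using (Vector)
open import Data.Vec.Properties using (insertAt-lookup; insertAt-punchIn)
open import Function using (_∘_; _⇔_; mk⇔; Equivalence)
open import Function.Related.TypeIsomorphisms using (¬-cong-⇔)
open import Level using (Level)
open import Relation.Binary using (IsPartialOrder; Rel)
open import Relation.Binary.PropositionalEquality
  using (_≡_; refl; sym; trans; cong; cong₂; subst; subst₂; isEquivalence; module ≡-Reasoning)
open import Relation.Nullary using (¬_; Dec; yes; no; does)
open import Relation.Nullary.Decidable using (_×-dec_; ¬?; dec-true; dec-false)
open import Relation.Unary using (Pred; Decidable)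

import Algebra.Properties.CommutativeMonoid.Sum as MonoidSum
open MonoidSum +-0-commutativeMonoid
  using (sum-syntax; sum-cong-≗; sum-remove; ∑-comm)
  renaming (sum to ∑)
module Product = MonoidSum *-1-commutativeMonoid

private
  variable
    α β p q : Level
    n : ℕ

-- Indicators and finite sums

𝟙 : {X : Set α} → Dec X → ℕ
𝟙 a? = if does a? then 1 else 0

𝟙-yes : {X : Set α} (a? : Dec X) → X → 𝟙 a? ≡ 1
𝟙-yes a? x rewrite dec-true a? x = refl

𝟙-no : {X : Set α} (a? : Dec X) → ¬ X → 𝟙 a? ≡ 0
𝟙-no a? ¬x rewrite dec-false a? ¬x = refl

𝟙≤1 : {X : Set α} (a? : Dec X) → 𝟙 a? ≤ 1
𝟙≤1 (yes _) = ≤-refl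
𝟙≤1 (no _)  = z≤n

𝟙-mono : {X : Set α} {Y : Set β} → (X → Y) → (a? : Dec X) (b? : Dec Y) → 𝟙 a? ≤ 𝟙 b?
𝟙-mono f (yes x) b? = ≤-reflexive (sym (𝟙-yes b? (f x)))
𝟙-mono f (no _)  b? = z≤n

𝟙-cong : {X : Set α} {Y : Set β} → X ⇔ Y → (a? : Dec X) (b? : Dec Y) → 𝟙 a? ≡ 𝟙 b?
𝟙-cong X⇔Y a? b? = ≤-antisym (𝟙-mono (Equivalence.to X⇔Y) a? b?) (𝟙-mono (Equivalence.from X⇔Y) b? a?)

𝟙-× : {X : Set α} {Y : Set β} (a? : Dec X) (b? : Dec Y) → 𝟙 (a? ×-dec b?) ≡ 𝟙 a? * 𝟙 b?
𝟙-× (yes _) (yes _) = refl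
𝟙-× (yes _) (no _)  = refl
𝟙-× (no _)  (yes _) = refl
𝟙-× (no _)  (no _)  = refl

𝟙-yes-* : {X : Set α} (a? : Dec X) → X → ∀ k → 𝟙 a? * k ≡ k
𝟙-yes-* a? x k = trans (cong (_* k) (𝟙-yes a? x)) (*-identityˡ k)

𝟙-*-≤ : ∀ {k l} {X : Set α} (a? : Dec X) → (X → k ≤ l) → 𝟙 a? * k ≤ l
𝟙-*-≤ {k = k} (yes x) k≤l = ≤-trans (≤-reflexive (*-identityˡ k)) (k≤l x)
𝟙-*-≤         (no _)  _   = z≤n

∏ : Vector ℕ n → ℕ
∏ = Product.sum

∑-mono-≤ : {f g : Vector ℕ n} → (∀ i → f i ≤ g i) → ∑ f ≤ ∑ g
∑-mono-≤ {zero}  f≤g = z≤n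
∑-mono-≤ {suc n} f≤g = +-mono-≤ (f≤g zero) (∑-mono-≤ (f≤g ∘ suc))

∑-mono-< : {f g : Vector ℕ n} → (∀ i → f i ≤ g i) → ∀ i → f i < g i → ∑ f < ∑ g
∑-mono-< f≤g zero    f<g = +-mono-<-≤ f<g (∑-mono-≤ (f≤g ∘ suc))
∑-mono-< f≤g (suc i) f<g = +-mono-≤-< (f≤g zero) (∑-mono-< (f≤g ∘ suc) i f<g)

≤-∑ : (f : Vector ℕ n) (i : Fin n) → f i ≤ ∑ f
≤-∑ f zero    = m≤m+n (f zero) _
≤-∑ f (suc i) = ≤-trans (≤-∑ (f ∘ suc) i) (m≤n+m _ (f zero))

∑-*ˡ : ∀ c (f : Vector ℕ n) → ∑[ i < n ] (c * f i) ≡ c * ∑ f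
∑-*ˡ {zero}  c f = sym (*-zeroʳ c)
∑-*ˡ {suc n} c f = trans (cong (c * f zero +_) (∑-*ˡ c (f ∘ suc))) (sym (*-distribˡ-+ c (f zero) _))

∑-*ʳ : ∀ c (f : Vector ℕ n) → ∑[ i < n ] (f i * c) ≡ ∑ f * c
∑-*ʳ {n} c f = trans (sum-cong-≗ {n = n} (λ i → *-comm (f i) c)) (trans (∑-*ˡ c f) (*-comm c (∑ f)))

count : {P : Pred (Fin n) p} → Decidable P → ℕ
count P? = ∑ (𝟙 ∘ P?)

foldr-tabulate : {A : Set α} {B : Set β} (_∙_ : A → B → B) (ε : B) (f : Vector A n) →
                 List.foldr _∙_ ε (tabulate f) ≡ Vector.foldr _∙_ ε f
foldr-tabulate {n = zero}  _∙_ ε f = refl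
foldr-tabulate {n = suc n} _∙_ ε f = cong (f zero ∙_) (foldr-tabulate _∙_ ε (f ∘ suc))

foldr-map-allFin : {A : Set α} {B : Set β} (_∙_ : A → B → B) (ε : B) (f : Vector A n) →
                   List.foldr _∙_ ε (map f (allFin n)) ≡ Vector.foldr _∙_ ε f
foldr-map-allFin _∙_ ε f = trans (cong (List.foldr _∙_ ε) (map-tabulate (λ i → i) f)) (foldr-tabulate _∙_ ε f)

length-filter≡sum : {X : Set α} {P : Pred X p} (P? : Decidable P) (xs : List X) →
                    length (filter P? xs) ≡ sum (map (𝟙 ∘ P?) xs)
length-filter≡sum P? []       = refl
length-filter≡sum P? (x ∷ xs) with does (P? x)
... | true  = cong suc (length-filter≡sum P? xs)
... | false = length-filter≡sum P? xs

length-filter-allFin : {P : Pred (Fin n) p} (P? : Decidable P) → length (filter P? (allFin n)) ≡ count P?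
length-filter-allFin P? = trans (length-filter≡sum P? (allFin _)) (foldr-map-allFin _+_ 0 (𝟙 ∘ P?))

count≤n : {P : Pred (Fin n) p} (P? : Decidable P) → count P? ≤ n
count≤n {zero}  P? = z≤n
count≤n {suc n} P? = +-mono-≤ (𝟙≤1 (P? zero)) (count≤n (P? ∘ suc))

count-pos : {P : Pred (Fin n) p} (P? : Decidable P) {i : Fin n} → P i → 0 < count P?
count-pos P? {i} Pi = ≤-trans (≤-reflexive (sym (𝟙-yes (P? i) Pi))) (≤-∑ (𝟙 ∘ P?) i)

count-⊂ : {P : Pred (Fin n) p} {Q : Pred (Fin n) q} (P? : Decidable P) (Q? : Decidable Q) →
          (∀ {i} → P i → Q i) → ∀ {i} → Q i → ¬ P i → count P? < count Q?
count-⊂ P? Q? P⊆Q {i} Qi ¬Pi = ∑-mono-< (λ j → 𝟙-mono P⊆Q (P? j) (Q? j)) i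
  (subst₂ _<_ (sym (𝟙-no (P? i) ¬Pi)) (sym (𝟙-yes (Q? i) Qi)) ≤-refl)

sum-concatMap : {X : Set α} {Y : Set β} (f : Y → ℕ) (g : X → List Y) (xs : List X) →
                sum (map f (concatMap g xs)) ≡ sum (map (λ x → sum (map f (g x))) xs)
sum-concatMap f g []       = refl
sum-concatMap f g (x ∷ xs) = begin
  sum (map f (g x List.++ concatMap g xs))            ≡⟨ cong sum (map-++ f (g x) (concatMap g xs)) ⟩
  sum (map f (g x) List.++ map f (concatMap g xs))    ≡⟨ sum-++ (map f (g x)) _ ⟩
  sum (map f (g x)) + sum (map f (concatMap g xs))    ≡⟨ cong (sum (map f (g x)) +_) (sum-concatMap f g xs) ⟩
  sum (map f (g x)) + sum (map (λ x → sum (map f (g x))) xs) ∎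
  where open ≡-Reasoning

-- Sums over all maps Fin n → Fin t

module VecSum (t : ℕ) where

  ∑ᵥ : (Vec (Fin t) n → ℕ) → ℕ
  ∑ᵥ {zero}  f = f []
  ∑ᵥ {suc n} f = ∑[ i < t ] ∑ᵥ (λ v → f (i ∷ v))

  ∑ᵥ-cong : {f g : Vec (Fin t) n → ℕ} → (∀ v → f v ≡ g v) → ∑ᵥ f ≡ ∑ᵥ g
  ∑ᵥ-cong {zero}  f≗g = f≗g []
  ∑ᵥ-cong {suc n} f≗g = sum-cong-≗ (λ i → ∑ᵥ-cong (λ v → f≗g (i ∷ v)))

  ∑ᵥ-*ˡ : ∀ c (f : Vec (Fin t) n → ℕ) → ∑ᵥ (λ v → c * f v) ≡ c * ∑ᵥ f
  ∑ᵥ-*ˡ {zero}  c f = refl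
  ∑ᵥ-*ˡ {suc n} c f =
    trans (sum-cong-≗ (λ i → ∑ᵥ-*ˡ c (λ v → f (i ∷ v)))) (∑-*ˡ c (λ i → ∑ᵥ (λ v → f (i ∷ v))))

  ∑ᵥ-insertAt : (k : Fin (suc n)) (f : Vec (Fin t) (suc n) → ℕ) →
                ∑ᵥ f ≡ ∑[ i < t ] ∑ᵥ (λ v → f (insertAt v k i))
  ∑ᵥ-insertAt         zero    f = refl
  ∑ᵥ-insertAt {suc n} (suc k) f =
    trans (sum-cong-≗ (λ i → ∑ᵥ-insertAt k (λ v → f (i ∷ v))))
          (∑-comm (λ j i → ∑ᵥ (λ v → f (j ∷ insertAt v k i))))

  sum-map-allVecs : (f : Vec (Fin t) n → ℕ) → sum (map f (allVecs n t)) ≡ ∑ᵥ f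
  sum-map-allVecs {zero}  f = +-identityʳ (f [])
  sum-map-allVecs {suc n} f = begin
    sum (map f (allVecs (suc n) t))
      ≡⟨ sum-concatMap f _ (allFin t) ⟩
    sum (map (λ i → sum (map f (vs i))) (allFin t))
      ≡⟨ foldr-map-allFin _+_ 0 (λ i → sum (map f (vs i))) ⟩
    ∑[ i < t ] sum (map f (vs i))
      ≡⟨ sum-cong-≗ (λ i → cong sum (sym (map-∘ {g = f} {f = i ∷_} (allVecs n t)))) ⟩
    ∑[ i < t ] sum (map (λ v → f (i ∷ v)) (allVecs n t))
      ≡⟨ sum-cong-≗ (λ i → sum-map-allVecs (λ v → f (i ∷ v))) ⟩
    ∑ᵥ f ∎
    where
    open ≡-Reasoning
    vs : Fin t → List (Vec (Fin t) (suc n))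
    vs i = map (i ∷_) (allVecs n t)

-- Power sums and capped products

∑₁ : ℕ → (ℕ → ℕ) → ℕ
∑₁ zero    g = 0
∑₁ (suc L) g = ∑₁ L g + g (suc L)

∑₁-mono-≤ : ∀ L {f g : ℕ → ℕ} → (∀ w → w ≤ L → f w ≤ g w) → ∑₁ L f ≤ ∑₁ L g
∑₁-mono-≤ zero    f≤g = z≤n
∑₁-mono-≤ (suc L) f≤g =
  +-mono-≤ (∑₁-mono-≤ L (λ w w≤L → f≤g w (m≤n⇒m≤1+n w≤L))) (f≤g (suc L) ≤-refl)

∑₁-*ˡ : ∀ L c (f : ℕ → ℕ) → ∑₁ L (λ w → c * f w) ≡ c * ∑₁ L f
∑₁-*ˡ zero    c f = sym (*-zeroʳ c)
∑₁-*ˡ (suc L) c f = trans (cong (_+ c * f (suc L)) (∑₁-*ˡ L c f)) (sym (*-distribˡ-+ c _ _))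

∑₁-const-1 : ∀ L → ∑₁ L (λ _ → 1) ≡ L
∑₁-const-1 zero    = refl
∑₁-const-1 (suc L) = trans (cong (_+ 1) (∑₁-const-1 L)) (+-comm L 1)

-- Substitute w = t − i.
∑-tail≡∑₁ : ∀ t c (g : ℕ → ℕ) → ∑[ i < t ] (𝟙 (c ≤? toℕ i) * g (t ∸ toℕ i)) ≡ ∑₁ (t ∸ c) g
∑-tail≡∑₁ zero    c       g = cong (λ L → ∑₁ L g) (sym (0∸n≡0 c))
∑-tail≡∑₁ (suc t) zero    g = begin
  g (suc t) + 0 + ∑[ i < t ] (1 * g (t ∸ toℕ i)) ≡⟨ cong₂ _+_ (+-identityʳ _) (∑-tail≡∑₁ t 0 g) ⟩
  g (suc t) + ∑₁ t g                             ≡⟨ +-comm (g (suc t)) _ ⟩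
  ∑₁ (suc t) g                                   ∎
  where open ≡-Reasoning
∑-tail≡∑₁ (suc t) (suc c) g = trans (sum-cong-≗ {n = t} 𝟙-shift) (∑-tail≡∑₁ t c g)
  where
  𝟙-shift : ∀ i → 𝟙 (suc c ≤? suc (toℕ i)) * g (t ∸ toℕ i) ≡ 𝟙 (c ≤? toℕ i) * g (t ∸ toℕ i)
  𝟙-shift i = cong (_* g (t ∸ toℕ i)) (𝟙-cong (mk⇔ s≤s⁻¹ s≤s) (suc c ≤? suc (toℕ i)) (c ≤? toℕ i))

-- (L+1)^j − L^j ≤ j (L+1)^(j−1), multiplied through by L+1 so that no subtraction occurs.
suc-^-difference : ∀ j L → suc L ^ suc j ≤ suc L * L ^ j + j * suc L ^ j
suc-^-difference zero    L = ≤-reflexive (sym (+-identityʳ _))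
suc-^-difference (suc j) L = begin
  suc L * (suc L * Y)                           ≤⟨ *-monoʳ-≤ (suc L) (suc-^-difference j L) ⟩
  suc L * (suc L * X + j * Y)                   ≡⟨ expand L X Y j ⟩
  suc L * (L * X) + suc L * X + j * (suc L * Y) ≤⟨ +-monoˡ-≤ (j * (suc L * Y)) (+-monoʳ-≤ (suc L * (L * X)) X≤Y) ⟩
  suc L * (L * X) + suc L * Y + j * (suc L * Y) ≡⟨ collect L X Y j ⟩
  suc L * (L * X) + suc j * (suc L * Y)         ∎
  where
  open ≤-Reasoning
  X = L ^ j
  Y = suc L ^ j
  X≤Y : suc L * X ≤ suc L * Y
  X≤Y = *-monoʳ-≤ (suc L) (^-monoˡ-≤ j (n≤1+n L))
  expand : ∀ L X Y j → suc L * (suc L * X + j * Y) ≡ suc L * (L * X) + suc L * X + j * (suc L * Y)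
  expand = solve-∀
  collect : ∀ L X Y j → suc L * (L * X) + suc L * Y + j * (suc L * Y) ≡ suc L * (L * X) + suc j * (suc L * Y)
  collect = solve-∀

∑₁-^-lower : ∀ k L → suc L * L ^ suc k ≤ suc (suc k) * ∑₁ L (_^ suc k)
∑₁-^-lower k zero    = z≤n
∑₁-^-lower k (suc L) = begin
  suc (suc L) * Y                ≡⟨ +-comm Y (suc L * Y) ⟩
  suc L * Y + Y                  ≤⟨ +-monoˡ-≤ Y (suc-^-difference (suc k) L) ⟩
  suc L * X + suc k * Y + Y      ≡⟨ regroup (suc L * X) (suc k * Y) Y ⟩
  suc L * X + suc (suc k) * Y    ≤⟨ +-monoˡ-≤ (suc (suc k) * Y) (∑₁-^-lower k L) ⟩
  suc (suc k) * S + suc (suc k) * Y ≡⟨ *-distribˡ-+ (suc (suc k)) S Y ⟨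
  suc (suc k) * (S + Y)          ∎
  where
  open ≤-Reasoning
  X = L ^ suc k
  Y = suc L ^ suc k
  S = ∑₁ L (_^ suc k)
  regroup : ∀ a b c → a + b + c ≡ a + (c + b)
  regroup a b c = trans (+-assoc a b c) (cong (a +_) (+-comm b c))

∑₁-^-bound : ∀ {ε} J L → ε ≤ 1 → ε ≤ J → (L + ε) * L ^ J ≤ suc J * ∑₁ L (_^ J)
∑₁-^-bound zero    L _   z≤n = ≤-reflexive (begin
  (L + 0) * 1      ≡⟨ *-identityʳ (L + 0) ⟩
  L + 0            ≡⟨ cong (_+ 0) (∑₁-const-1 L) ⟨
  ∑₁ L (λ _ → 1) + 0 ∎)
  where open ≡-Reasoning
∑₁-^-bound (suc k) L ε≤1 _ = begin
  (L + _) * L ^ suc k ≤⟨ *-monoˡ-≤ (L ^ suc k) (+-monoʳ-≤ L ε≤1) ⟩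
  (L + 1) * L ^ suc k ≡⟨ cong (_* L ^ suc k) (+-comm L 1) ⟩
  suc L * L ^ suc k   ≤⟨ ∑₁-^-lower k L ⟩
  suc (suc k) * ∑₁ L (_^ suc k) ∎
  where open ≤-Reasoning

cap-bound : ∀ {w L} a e → w ≤ L → a ≤ L → w * (a + e) ≤ L * (a ⊓ w + e)
cap-bound {w} {L} a e w≤L a≤L with ≤-total a w
... | inj₁ a≤w rewrite m≤n⇒m⊓n≡m a≤w = *-monoˡ-≤ (a + e) w≤L
... | inj₂ w≤a rewrite m≥n⇒m⊓n≡n w≤a = begin
  w * (a + e)   ≡⟨ *-distribˡ-+ w a e ⟩
  w * a + w * e ≤⟨ +-mono-≤ (≤-trans (≤-reflexive (*-comm w a)) (*-monoˡ-≤ w a≤L)) (*-monoˡ-≤ e w≤L) ⟩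
  L * w + L * e ≡⟨ *-distribˡ-+ L w e ⟨
  L * (w + e)   ∎
  where open ≤-Reasoning

∸-⊔-𝟙* : ∀ t x k {X : Set α} (a? : Dec X) →
          t ∸ (x ⊔ 𝟙 a? * k) ≡ (if does a? then (t ∸ x) ⊓ (t ∸ k) else t ∸ x)
∸-⊔-𝟙* t x k (yes _) = trans (cong (λ j → t ∸ (x ⊔ j)) (+-identityʳ k)) (∸-distribˡ-⊔-⊓ t x k)
∸-⊔-𝟙* t x k (no _)  = cong (t ∸_) (⊔-identityʳ x)

capped : {U : Pred (Fin n) p} → Decidable U → (a e : Vector ℕ n) → ℕ → ℕ
capped U? a e w = ∏ (λ y → (if does (U? y) then a y ⊓ w else a y) + e y)

capped-lower : ∀ {L w} {U : Pred (Fin n) p} (U? : Decidable U) (a e : Vector ℕ n) →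
               (∀ y → U y → a y ≤ L) → w ≤ L →
               w ^ count U? * ∏ (λ y → a y + e y) ≤ L ^ count U? * capped U? a e w
capped-lower {zero}          U? a e a≤L w≤L = ≤-refl
capped-lower {suc n} {L = L} {w} U? a e a≤L w≤L
  with U? zero | capped-lower (U? ∘ suc) (a ∘ suc) (e ∘ suc) (a≤L ∘ suc) w≤L
... | yes U₀ | ih = begin
  (w * w ^ J) * ((a₀ + e₀) * A) ≡⟨ interchange w (w ^ J) (a₀ + e₀) A ⟩
  (w * (a₀ + e₀)) * (w ^ J * A) ≤⟨ *-mono-≤ (cap-bound a₀ e₀ w≤L (a≤L zero U₀)) ih ⟩
  (L * (a₀ ⊓ w + e₀)) * (L ^ J * F) ≡⟨ interchange L (L ^ J) (a₀ ⊓ w + e₀) F ⟨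
  (L * L ^ J) * ((a₀ ⊓ w + e₀) * F) ∎
  where
  open ≤-Reasoning
  a₀ = a zero
  e₀ = e zero
  J = count (U? ∘ suc)
  A = ∏ (λ y → a (suc y) + e (suc y))
  F = capped (U? ∘ suc) (a ∘ suc) (e ∘ suc) w
... | no _ | ih = begin
  w ^ J * ((a zero + e zero) * A) ≡⟨ x∙yz≈y∙xz (w ^ J) (a zero + e zero) A ⟩
  (a zero + e zero) * (w ^ J * A) ≤⟨ *-monoʳ-≤ (a zero + e zero) ih ⟩
  (a zero + e zero) * (L ^ J * F) ≡⟨ x∙yz≈y∙xz (a zero + e zero) (L ^ J) F ⟩
  L ^ J * ((a zero + e zero) * F) ∎
  where
  open ≤-Reasoning
  J = count (U? ∘ suc)
  A = ∏ (λ y → a (suc y) + e (suc y))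
  F = capped (U? ∘ suc) (a ∘ suc) (e ∘ suc) w

∑₁-capped-lower : ∀ {L ε} .{{_ : NonZero L}} {U : Pred (Fin n) p} (U? : Decidable U) (a e : Vector ℕ n) →
                  (∀ y → U y → a y ≤ L) → ε ≤ 1 → ε ≤ count U? →
                  (L + ε) * ∏ (λ y → a y + e y) ≤ suc (count U?) * ∑₁ L (capped U? a e)
∑₁-capped-lower {L = L} {ε} U? a e a≤L ε≤1 ε≤J = *-cancelˡ-≤ (L ^ J) {{m^n≢0 L J}} (begin
  L ^ J * ((L + ε) * A)        ≡⟨ x∙yz≈y∙xz (L ^ J) (L + ε) A ⟩
  (L + ε) * (L ^ J * A)        ≡⟨ *-assoc (L + ε) (L ^ J) A ⟨
  ((L + ε) * L ^ J) * A        ≤⟨ *-monoˡ-≤ A (∑₁-^-bound J L ε≤1 ε≤J) ⟩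
  (suc J * ∑₁ L (_^ J)) * A    ≡⟨ *-assoc (suc J) (∑₁ L (_^ J)) A ⟩
  suc J * (∑₁ L (_^ J) * A)    ≡⟨ cong (suc J *_) (*-comm (∑₁ L (_^ J)) A) ⟩
  suc J * (A * ∑₁ L (_^ J))    ≤⟨ *-monoʳ-≤ (suc J) weighted ⟩
  suc J * (L ^ J * ∑₁ L F)     ≡⟨ x∙yz≈y∙xz (suc J) (L ^ J) (∑₁ L F) ⟩
  L ^ J * (suc J * ∑₁ L F)     ∎)
  where
  open ≤-Reasoning
  J = count U?
  A = ∏ (λ y → a y + e y)
  F = capped U? a e
  weighted : A * ∑₁ L (_^ J) ≤ L ^ J * ∑₁ L F
  weighted = begin
    A * ∑₁ L (_^ J)             ≡⟨ ∑₁-*ˡ L A (_^ J) ⟨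
    ∑₁ L (λ w → A * w ^ J)      ≤⟨ ∑₁-mono-≤ L (λ w w≤L →
                                     subst (_≤ L ^ J * F w) (*-comm (w ^ J) A) (capped-lower U? a e a≤L w≤L)) ⟩
    ∑₁ L (λ w → L ^ J * F w)    ≡⟨ ∑₁-*ˡ L (L ^ J) F ⟩
    L ^ J * ∑₁ L F              ∎

-- Posets: extremal elements and deleting a minimal element

count-punchIn : {P : Pred (Fin (suc n)) p} (P? : Decidable P) (k : Fin (suc n)) →
                count P? ≡ 𝟙 (P? k) + count (P? ∘ punchIn k)
count-punchIn P? k = sum-remove {i = k} (𝟙 ∘ P?)

b≡count : (P : FinPoset n) (x : Fin n) → b P x ≡ count (_≼?_ P x)
b≡count P x = length-filter-allFin (_≼?_ P x)

punchIn-or-≡ : (k x : Fin (suc n)) → x ≡ k ⊎ ∃ λ y → punchIn k y ≡ x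
punchIn-or-≡ k x with k ≟ᶠ x
... | yes k≡x = inj₁ (sym k≡x)
... | no  k≢x = inj₂ (punchOut k≢x , punchIn-punchOut k≢x)

IsMinimal : FinPoset n → Fin n → Set
IsMinimal P x = ∀ y → ¬ (_≺_ P y x)

descend : {_⊏_ : Rel (Fin n) p} → (∀ x y → Dec (x ⊏ y)) → (μ : Fin n → ℕ) →
          (∀ {x y} → x ⊏ y → μ x < μ y) → ∀ k x → μ x < k → ∃ λ m → ∀ y → ¬ (y ⊏ m)
descend _⊏?_ μ μ-mono (suc k) x μx≤k with any? (λ y → y ⊏? x)
... | yes (y , y⊏x) = descend _⊏?_ μ μ-mono k y (<-≤-trans (μ-mono y⊏x) (s≤s⁻¹ μx≤k))
... | no  ∄y⊏x     = x , λ y y⊏x → ∄y⊏x (y , y⊏x)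

module _ (P : FinPoset n) where
  open IsPartialOrder (isPartialOrder P) using (antisym) renaming (refl to ≼-refl; trans to ≼-trans)

  ∃-minimal : Fin n → ∃ (IsMinimal P)
  ∃-minimal x = descend (_≺?_ P) (λ z → count (λ y → _≼?_ P y z)) shrinks _ x ≤-refl
    where
    shrinks : ∀ {x y} → _≺_ P x y → count (λ z → _≼?_ P z x) < count (λ z → _≼?_ P z y)
    shrinks {x} {y} (x≼y , x≢y) = count-⊂ (λ z → _≼?_ P z x) (λ z → _≼?_ P z y)
      (λ z≼x → ≼-trans z≼x x≼y) {y} ≼-refl (λ y≼x → x≢y (antisym x≼y y≼x))

  ∃-maximal : Fin n → ∃ (IsMaximal P)
  ∃-maximal x = descend (λ y z → _≺?_ P z y) (b P) shrinks _ x ≤-refl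
    where
    shrinks : ∀ {x y} → _≺_ P y x → b P x < b P y
    shrinks {x} {y} (y≼x , y≢x) = subst₂ _<_ (sym (b≡count P x)) (sym (b≡count P y))
      (count-⊂ (_≼?_ P x) (_≼?_ P y) (≼-trans y≼x) {y} ≼-refl (λ x≼y → y≢x (antisym y≼x x≼y)))

numMax-pos : (P : FinPoset (suc n)) → 0 < numMax P
numMax-pos P with ∃-maximal P zero
... | x , x-max = subst (0 <_) (sym (length-filter-allFin (isMaximal? P))) (count-pos (isMaximal? P) x-max)

_∖_ : FinPoset (suc n) → Fin (suc n) → FinPoset n
P ∖ k = record
  { _≼_            = λ x y → _≼_ P (punchIn k x) (punchIn k y)
  ; _≼?_           = λ x y → _≼?_ P (punchIn k x) (punchIn k y)
  ; isPartialOrder = record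
    { isPreorder = record
      { isEquivalence = isEquivalence
      ; reflexive     = λ { refl → ≼.refl }
      ; trans         = ≼.trans
      }
    ; antisym    = λ x≼y y≼x → punchIn-injective k _ _ (≼.antisym x≼y y≼x)
    }
  }
  where module ≼ = IsPartialOrder (isPartialOrder P)

module RemoveMinimal (P : FinPoset (suc n)) (m : Fin (suc n)) (m-min : IsMinimal P m) where

  P′ : FinPoset n
  P′ = P ∖ m

  ≺-punchIn : ∀ {x y} → _≺_ P′ x y → _≺_ P (punchIn m x) (punchIn m y)
  ≺-punchIn (x≼y , x≢y) = x≼y , x≢y ∘ punchIn-injective m _ _

  ≺-punchIn⁻ : ∀ {x y} → _≺_ P (punchIn m x) (punchIn m y) → _≺_ P′ x y
  ≺-punchIn⁻ (x≼y , x≢y) = x≼y , x≢y ∘ cong (punchIn m)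

  ⋠-minimal : ∀ y → ¬ _≼_ P (punchIn m y) m
  ⋠-minimal y y≼m = m-min (punchIn m y) (y≼m , punchInᵢ≢i m y)

  b-punchIn : ∀ y → b P (punchIn m y) ≡ b P′ y
  b-punchIn y = begin
    b P (punchIn m y)
      ≡⟨ b≡count P (punchIn m y) ⟩
    count (_≼?_ P (punchIn m y))
      ≡⟨ count-punchIn (_≼?_ P (punchIn m y)) m ⟩
    𝟙 (_≼?_ P (punchIn m y) m) + count (_≼?_ P′ y)
      ≡⟨ cong (_+ count (_≼?_ P′ y)) (𝟙-no (_≼?_ P _ m) (⋠-minimal y)) ⟩
    count (_≼?_ P′ y)
      ≡⟨ b≡count P′ y ⟨
    b P′ y ∎
    where open ≡-Reasoning

  #above : ℕ
  #above = count (λ y → _≺?_ P m (punchIn m y))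

  b-minimal : b P m ≡ suc #above
  b-minimal = begin
    b P m
      ≡⟨ b≡count P m ⟩
    count (_≼?_ P m)
      ≡⟨ count-punchIn (_≼?_ P m) m ⟩
    𝟙 (_≼?_ P m m) + count (_≼?_ P m ∘ punchIn m)
      ≡⟨ cong₂ _+_ (𝟙-yes (_≼?_ P m m) ≼-refl) (sum-cong-≗ {n = n} ≼⇔≺) ⟩
    suc #above ∎
    where
    open ≡-Reasoning
    open IsPartialOrder (isPartialOrder P) using () renaming (refl to ≼-refl)
    ≼⇔≺ : ∀ y → 𝟙 (_≼?_ P m (punchIn m y)) ≡ 𝟙 (_≺?_ P m (punchIn m y))
    ≼⇔≺ y = 𝟙-cong (mk⇔ (λ m≼y → m≼y , punchInᵢ≢i m y ∘ sym) proj₁)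
                   (_≼?_ P m (punchIn m y)) (_≺?_ P m (punchIn m y))

  prodB-minimal : prodB P ≡ b P m * prodB P′
  prodB-minimal = begin
    prodB P                              ≡⟨ foldr-map-allFin _*_ 1 (b P) ⟩
    ∏ (b P)                              ≡⟨ Product.sum-remove {i = m} (b P) ⟩
    b P m * ∏ (b P ∘ punchIn m)          ≡⟨ cong (b P m *_) (Product.sum-cong-≗ {n = n} b-punchIn) ⟩
    b P m * ∏ (b P′)                     ≡⟨ cong (b P m *_) (foldr-map-allFin _*_ 1 (b P′)) ⟨
    b P m * prodB P′                     ∎
    where open ≡-Reasoning

  isMaximal-punchIn : ∀ y → IsMaximal P (punchIn m y) ⇔ IsMaximal P′ y
  isMaximal-punchIn y = mk⇔ (λ y-max z y≺z → y-max (punchIn m z) (≺-punchIn y≺z)) from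
    where
    from : IsMaximal P′ y → IsMaximal P (punchIn m y)
    from y-max z y≺z with punchIn-or-≡ m z
    ... | inj₁ refl          = ⋠-minimal y (proj₁ y≺z)
    ... | inj₂ (z′ , refl)   = y-max z′ (≺-punchIn⁻ y≺z)

  #above-pos : ¬ IsMaximal P m → 0 < #above
  #above-pos m-not-max with any? (_≺?_ P m)
  ... | no  ∄z      = ⊥-elim (m-not-max (λ z m≺z → ∄z (z , m≺z)))
  ... | yes (z , m≺z) with punchIn-or-≡ m z
  ...   | inj₁ refl        = ⊥-elim (proj₂ m≺z refl)
  ...   | inj₂ (z′ , refl) = count-pos (λ y → _≺?_ P m (punchIn m y)) m≺z

-- Order-preserving maps above a lower bound

module Counting (t : ℕ) where
  open VecSum t

  Admissible : FinPoset n → (Fin n → ℕ) → (Fin n → Fin t) → Set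
  Admissible P ℓ g = OrderPreserving P g × (∀ x → ℓ x ≤ toℕ (g x))

  admissible? : (P : FinPoset n) (ℓ : Fin n → ℕ) (g : Fin n → Fin t) → Dec (Admissible P ℓ g)
  admissible? P ℓ g = orderPreserving? P g ×-dec all? (λ x → ℓ x ≤? toℕ (g x))

  admissible-≗ : (P : FinPoset n) (ℓ : Fin n → ℕ) {g h : Fin n → Fin t} →
                 (∀ x → g x ≡ h x) → Admissible P ℓ g → Admissible P ℓ h
  admissible-≗ P ℓ g≗h (g-mono , ℓ≤g) =
    (λ x y x≺y → subst₂ (λ u v → u Fin.≤ v) (g≗h x) (g≗h y) (g-mono x y x≺y)) ,
    (λ x → subst (λ u → ℓ x ≤ toℕ u) (g≗h x) (ℓ≤g x))

  #admissible : FinPoset n → (Fin n → ℕ) → ℕ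
  #admissible P ℓ = ∑ᵥ (λ v → 𝟙 (admissible? P ℓ (lookup v)))

  #admissible-0 : (P : FinPoset n) → #admissible P (λ _ → 0) ≡ Ω P t
  #admissible-0 {n} P = begin
    ∑ᵥ (λ v → 𝟙 (admissible? P (λ _ → 0) (lookup v)))                 ≡⟨ ∑ᵥ-cong {n} bound-vacuous ⟩
    ∑ᵥ (λ v → 𝟙 (op? v))                                               ≡⟨ sum-map-allVecs {n} (𝟙 ∘ op?) ⟨
    sum (map (𝟙 ∘ op?) (allVecs n t))                                  ≡⟨ length-filter≡sum op? (allVecs n t) ⟨
    Ω P t                                                              ∎
    where
    open ≡-Reasoning
    op? = λ (v : Vec (Fin t) n) → orderPreserving? P (lookup v)
    bound-vacuous : ∀ v → 𝟙 (admissible? P (λ _ → 0) (lookup v)) ≡ 𝟙 (op? v)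
    bound-vacuous v = 𝟙-cong (mk⇔ proj₁ (_, λ _ → z≤n)) (admissible? P (λ _ → 0) (lookup v)) (op? v)

  weight : FinPoset n → (Fin n → ℕ) → ℕ
  weight P ℓ = ∏ (λ x → t ∸ ℓ x + 𝟙 (¬? (isMaximal? P x)))

  ∏-+𝟙 : {Q : Pred (Fin n) p} (Q? : Decidable Q) →
          ∏ (λ x → t + 𝟙 (¬? (Q? x))) ≡ t ^ count Q? * suc t ^ (n ∸ count Q?)
  ∏-+𝟙 {zero}  Q? = refl
  ∏-+𝟙 {suc n} Q? with Q? zero | ∏-+𝟙 (Q? ∘ suc)
  ... | yes _ | ih = trans (cong₂ _*_ (+-identityʳ t) ih) (sym (*-assoc t _ _))
  ... | no  _ | ih = begin
    (t + 1) * ∏ (λ x → t + 𝟙 (¬? (Q? (suc x))))   ≡⟨ cong₂ _*_ (+-comm t 1) ih ⟩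
    suc t * (t ^ k * suc t ^ (n ∸ k))              ≡⟨ x∙yz≈y∙xz (suc t) (t ^ k) _ ⟩
    t ^ k * suc t ^ suc (n ∸ k)                    ≡⟨ cong (λ j → t ^ k * suc t ^ j) (+-∸-assoc 1 (count≤n (Q? ∘ suc))) ⟨
    t ^ k * suc t ^ (suc n ∸ k)                    ∎
    where
    open ≡-Reasoning
    k = count (Q? ∘ suc)

  weight-0 : (P : FinPoset n) → weight P (λ _ → 0) ≡ t ^ numMax P * suc t ^ (n ∸ numMax P)
  weight-0 {n} P = trans (∏-+𝟙 (isMaximal? P))
                         (cong (λ r → t ^ r * suc t ^ (n ∸ r)) (sym (length-filter-allFin (isMaximal? P))))

  Monotone : FinPoset n → (Fin n → ℕ) → Set
  Monotone P ℓ = ∀ x y → _≼_ P x y → ℓ x ≤ ℓ y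

  module Step (P : FinPoset (suc n)) (m : Fin (suc n)) (m-min : IsMinimal P m)
              (ℓ : Fin (suc n) → ℕ) (ℓ-mono : Monotone P ℓ) (ℓ<t : ∀ x → ℓ x < t) where
    open RemoveMinimal P m m-min
    open IsPartialOrder (isPartialOrder P) using () renaming (trans to ≼-trans)

    -- Once m is sent to i, every element above m must take a value ≥ i as well.
    raise : Fin t → Fin n → ℕ
    raise i y = ℓ (punchIn m y) ⊔ 𝟙 (_≺?_ P m (punchIn m y)) * toℕ i

    i≤raise : ∀ i y → _≺_ P m (punchIn m y) → toℕ i ≤ raise i y
    i≤raise i y m≺y = ≤-trans (≤-reflexive (sym (𝟙-yes-* (_≺?_ P m (punchIn m y)) m≺y (toℕ i))))
                              (m≤n⊔m (ℓ (punchIn m y)) _)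

    raise-lub : ∀ {k} i y → ℓ (punchIn m y) ≤ k → (_≺_ P m (punchIn m y) → toℕ i ≤ k) → raise i y ≤ k
    raise-lub i y ℓ≤k i≤k = ⊔-lub ℓ≤k (𝟙-*-≤ (_≺?_ P m (punchIn m y)) i≤k)

    raise<t : ∀ i y → raise i y < t
    raise<t i y = ⊔-lub (ℓ<t (punchIn m y))
                        (≤-trans (s≤s (𝟙-*-≤ (_≺?_ P m (punchIn m y)) (λ _ → ≤-refl))) (toℕ<n i))

    raise-mono : ∀ i → Monotone P′ (raise i)
    raise-mono i x y x≼y = raise-lub i x (≤-trans (ℓ-mono _ _ x≼y) (m≤m⊔n _ _))
      (λ m≺x → i≤raise i y (≼-trans (proj₁ m≺x) x≼y , punchInᵢ≢i m y ∘ sym))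

    admissible-split : (g : Fin (suc n) → Fin t) (i : Fin t) (h : Fin n → Fin t) → g m ≡ i →
                       (∀ y → g (punchIn m y) ≡ h y) →
                       Admissible P ℓ g ⇔ (ℓ m ≤ toℕ i × Admissible P′ (raise i) h)
    admissible-split g _ h refl g≗h = mk⇔ to from
      where
      to : Admissible P ℓ g → ℓ m ≤ toℕ (g m) × Admissible P′ (raise (g m)) h
      to (g-mono , ℓ≤g) = ℓ≤g m , admissible-≗ P′ (raise (g m)) g≗h
        ( (λ x y x≺y → g-mono _ _ (≺-punchIn x≺y))
        , (λ y → raise-lub (g m) y (ℓ≤g (punchIn m y)) (g-mono m (punchIn m y))))
      from : ℓ m ≤ toℕ (g m) × Admissible P′ (raise (g m)) h → Admissible P ℓ g
      from (ℓ≤gm , h-adm) = g-mono , ℓ≤g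
        where
        g′-mono = proj₁ (admissible-≗ P′ (raise (g m)) (sym ∘ g≗h) h-adm)
        raise≤g′ = proj₂ (admissible-≗ P′ (raise (g m)) (sym ∘ g≗h) h-adm)
        g-mono : OrderPreserving P g
        g-mono x y x≺y with punchIn-or-≡ m x | punchIn-or-≡ m y
        ... | inj₁ refl        | inj₁ refl        = ⊥-elim (proj₂ x≺y refl)
        ... | inj₁ refl        | inj₂ (y′ , refl) = ≤-trans (i≤raise (g m) y′ x≺y) (raise≤g′ y′)
        ... | inj₂ (x′ , refl) | inj₁ refl        = ⊥-elim (m-min _ x≺y)
        ... | inj₂ (x′ , refl) | inj₂ (y′ , refl) = g′-mono x′ y′ (≺-punchIn⁻ x≺y)
        ℓ≤g : ∀ x → ℓ x ≤ toℕ (g x)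
        ℓ≤g x with punchIn-or-≡ m x
        ... | inj₁ refl        = ℓ≤gm
        ... | inj₂ (x′ , refl) = ≤-trans (m≤m⊔n _ _) (raise≤g′ x′)

    #admissible-minimal : #admissible P ℓ ≡ ∑[ i < t ] (𝟙 (ℓ m ≤? toℕ i) * #admissible P′ (raise i))
    #admissible-minimal =
      trans (∑ᵥ-insertAt m (λ w → 𝟙 (admissible? P ℓ (lookup w)))) (sum-cong-≗ {n = t} λ i →
        trans (∑ᵥ-cong {n} (λ v → insert-𝟙 v i))
              (∑ᵥ-*ˡ (𝟙 (ℓ m ≤? toℕ i)) (λ v → 𝟙 (admissible? P′ (raise i) (lookup v)))))
      where
      insert-𝟙 : ∀ v i → 𝟙 (admissible? P ℓ (lookup (insertAt v m i)))
                       ≡ 𝟙 (ℓ m ≤? toℕ i) * 𝟙 (admissible? P′ (raise i) (lookup v))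
      insert-𝟙 v i = trans
        (𝟙-cong (admissible-split (lookup (insertAt v m i)) i (lookup v) (insertAt-lookup v m i) (insertAt-punchIn v m i))
                (admissible? P ℓ (lookup (insertAt v m i)))
                ((ℓ m ≤? toℕ i) ×-dec admissible? P′ (raise i) (lookup v)))
        (𝟙-× (ℓ m ≤? toℕ i) (admissible? P′ (raise i) (lookup v)))

    a : Fin n → ℕ
    a y = t ∸ ℓ (punchIn m y)

    e : Fin n → ℕ
    e y = 𝟙 (¬? (isMaximal? P′ y))

    weight-minimal : weight P ℓ ≡ (t ∸ ℓ m + 𝟙 (¬? (isMaximal? P m))) * ∏ (λ y → a y + e y)
    weight-minimal = trans (Product.sum-remove {i = m} (λ x → t ∸ ℓ x + 𝟙 (¬? (isMaximal? P x))))
      (cong ((t ∸ ℓ m + 𝟙 (¬? (isMaximal? P m))) *_) (Product.sum-cong-≗ {n = n} λ y → cong (a y +_)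
        (𝟙-cong (¬-cong-⇔ (isMaximal-punchIn y)) (¬? (isMaximal? P (punchIn m y))) (¬? (isMaximal? P′ y)))))

    weight-raise : ∀ i → weight P′ (raise i) ≡ capped (λ y → _≺?_ P m (punchIn m y)) a e (t ∸ toℕ i)
    weight-raise i = Product.sum-cong-≗ {n = n} λ y →
      cong (_+ e y) (∸-⊔-𝟙* t (ℓ (punchIn m y)) (toℕ i) (_≺?_ P m (punchIn m y)))

    weight-minimal-bound : weight P ℓ ≤ b P m * ∑[ i < t ] (𝟙 (ℓ m ≤? toℕ i) * weight P′ (raise i))
    weight-minimal-bound = begin
      weight P ℓ
        ≡⟨ weight-minimal ⟩
      (L + ε) * ∏ (λ y → a y + e y)
        ≤⟨ ∑₁-capped-lower {{L≢0}} U? a e a≤L (𝟙≤1 ε?) ε≤#above ⟩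
      suc #above * ∑₁ L F
        ≡⟨ cong₂ _*_ b-minimal (∑-tail≡∑₁ t (ℓ m) F) ⟨
      b P m * ∑[ i < t ] (𝟙 (ℓ m ≤? toℕ i) * F (t ∸ toℕ i))
        ≡⟨ cong (b P m *_) (sum-cong-≗ {n = t} λ i → cong (𝟙 (ℓ m ≤? toℕ i) *_) (weight-raise i)) ⟨
      b P m * ∑[ i < t ] (𝟙 (ℓ m ≤? toℕ i) * weight P′ (raise i)) ∎
      where
      open ≤-Reasoning
      L = t ∸ ℓ m
      ε? = ¬? (isMaximal? P m)
      ε = 𝟙 ε?
      U? = λ y → _≺?_ P m (punchIn m y)
      F = capped U? a e
      L≢0 : NonZero L
      L≢0 = >-nonZero (m<n⇒0<n∸m (ℓ<t m))
      a≤L : ∀ y → _≺_ P m (punchIn m y) → a y ≤ L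
      a≤L y m≺y = ∸-monoʳ-≤ t (ℓ-mono m (punchIn m y) (proj₁ m≺y))
      ε≤#above : ε ≤ #above
      ε≤#above = ≤-trans (≤-reflexive (sym (*-identityʳ ε))) (𝟙-*-≤ ε? #above-pos)

    step : (∀ i → weight P′ (raise i) ≤ #admissible P′ (raise i) * prodB P′) →
           weight P ℓ ≤ #admissible P ℓ * prodB P
    step IH = begin
      weight P ℓ
        ≤⟨ weight-minimal-bound ⟩
      b P m * ∑[ i < t ] (𝟙 (ℓ m ≤? toℕ i) * weight P′ (raise i))
        ≤⟨ *-monoʳ-≤ (b P m) (∑-mono-≤ λ i → *-monoʳ-≤ (𝟙 (ℓ m ≤? toℕ i)) (IH i)) ⟩
      b P m * ∑[ i < t ] (𝟙 (ℓ m ≤? toℕ i) * (C i * prodB P′))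
        ≡⟨ cong (b P m *_) (trans (sum-cong-≗ {n = t} λ i → sym (*-assoc (𝟙 (ℓ m ≤? toℕ i)) (C i) (prodB P′)))
                                  (∑-*ʳ (prodB P′) λ i → 𝟙 (ℓ m ≤? toℕ i) * C i)) ⟩
      b P m * (∑[ i < t ] (𝟙 (ℓ m ≤? toℕ i) * C i) * prodB P′)
        ≡⟨ cong (λ c → b P m * (c * prodB P′)) #admissible-minimal ⟨
      b P m * (#admissible P ℓ * prodB P′)
        ≡⟨ x∙yz≈y∙xz (b P m) (#admissible P ℓ) (prodB P′) ⟩
      #admissible P ℓ * (b P m * prodB P′)
        ≡⟨ cong (#admissible P ℓ *_) prodB-minimal ⟨
      #admissible P ℓ * prodB P
        ∎
      where
      open ≤-Reasoning
      C = λ i → #admissible P′ (raise i)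

  weight≤#admissible*prodB : ∀ n (P : FinPoset n) (ℓ : Fin n → ℕ) → Monotone P ℓ → (∀ x → ℓ x < t) →
                             weight P ℓ ≤ #admissible P ℓ * prodB P
  weight≤#admissible*prodB zero    P ℓ _      _   = ≤-reflexive (sym (cong (λ c → c * 1)
    (𝟙-yes (admissible? P ℓ (lookup {A = Fin t} [])) ((λ ()) , λ ()))))
  weight≤#admissible*prodB (suc n) P ℓ ℓ-mono ℓ<t with ∃-minimal P zero
  ... | m , m-min = Step.step P m m-min ℓ ℓ-mono ℓ<t λ i →
    weight≤#admissible*prodB n (P ∖ m) (raise i) (raise-mono i) (raise<t i)
    where open Step P m m-min ℓ ℓ-mono ℓ<t using (raise; raise-mono; raise<t)

  Ω-lower-bound : (P : FinPoset n) → (Fin n → 0 < t) →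
                  t ^ numMax P * suc t ^ (n ∸ numMax P) ≤ Ω P t * prodB P
  Ω-lower-bound {n} P t>0 = subst₂ (λ l c → l ≤ c * prodB P) (weight-0 P) (#admissible-0 P)
    (weight≤#admissible*prodB n P (λ _ → 0) (λ _ _ _ → z≤n) t>0)

0^n≡0 : ∀ {k} → 0 < k → 0 ^ k ≡ 0
0^n≡0 (s≤s _) = refl

theorem1p2 : (n : ℕ) (P : FinPoset n) (t : ℕ) →
    (t ^ numMax P) * (suc t ^ (n ∸ numMax P)) ≤ Ω P t * prodB P
theorem1p2 zero    P t       = Counting.Ω-lower-bound t P (λ ())
theorem1p2 (suc n) P (suc t) = Counting.Ω-lower-bound (suc t) P (λ _ → s≤s z≤n)
theorem1p2 (suc n) P zero    =
  subst (_≤ Ω P 0 * prodB P) (cong (_* (1 ^ (suc n ∸ numMax P))) (sym (0^n≡0 (numMax-pos P)))) z≤n
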